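{- Let $d\ge2$. If a $d$-permutation $\boldsymbol\pi$ contains an occurrence of the pattern $(21,12)$, then $\boldsymbol\pi$ is not admissible with respect to ${\bf C}_F$.
   Context: A $d$-permutation of size $n$ is a tuple $\boldsymbol{\pi}=(\pi_1,\ldots,\pi_{d-1})$ of permutations of $[n]$; put $\pi_0=\mathrm{id}$. Its points are $(i,\pi_1(i),\ldots,\pi_{d-1}(i))$, $i\in[n]$; $\pi_l(p)$ is the $l$-th coordinate of $p$. For distinct points $p,q$, ${\bf dir}(p,q)=(\mathrm{sign}(\pi_0(q)-\pi_0(p)),\ldots,\mathrm{sign}(\pi_{d-1}(q)-\pi_{d-1}(p)))$. $\mathbb{F}^d$ is the set of directions in $\{+1,-1\}^d$ with last entry $-1$. Max-tree $\gamma^d(\boldsymbol\pi)$: a rooted tree in which every node is a leaf or internal with $2^{d-1}$ children labelled by the directions of $\mathbb{F}^d$; empty $\boldsymbol\pi$ gives a leaf; otherwise the root corresponds to the point $p_{\max}$ with $\pi_{d-1}(p_{\max})=n$ and the child labelled ${\bf f}$ is the max-tree of the sub-$d$-permutation of points $p'$ with ${\bf dir}(p_{\max},p')={\bf f}$ (relabelled order-preservingly). Internal nodes correspond to points; $\mathcal{T}_{\bf f}(r)$ is the subtree at the child of $r$ labelled ${\bf f}$. $F=\{{\bf dir}^0,\ldots,{\bf dir}^{d-1}\}$ with ${\bf dir}^i=(+1$ repeated $i$ times, $-1$ repeated $d-i$ times$)$. ${\bf C}_F=(C,\ldots,C)$ ($d$ copies) where $C$ orders $F$ by ${\bf dir}^i$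 before ${\bf dir}^j$ iff $i<j$. $\boldsymbol\pi$ is admissible with respect to ${\bf C}_F$ if (i) for every internal node $r$ of $\gamma^d(\boldsymbol\pi)$, every $l\in\{0,\ldots,d-1\}$ and all $i<j$, every point of a node of $\mathcal{T}_{{\bf dir}^i}(r)$ has smaller $l$-th coordinate than every point of a node of $\mathcal{T}_{{\bf dir}^j}(r)$; and (ii) there are no internal nodes $r_1,r_2$ with $r_1\in\mathcal{T}_{\bf f}(r_2)$ for some ${\bf f}\in\mathbb{F}^d\setminus F$. $\boldsymbol\pi$ contains the $3$-permutation $(21,12)$ (via a direct projection) iff there are points $p,q$ and indices $0\le i<j<k\le d-1$ with $\pi_i(p)<\pi_i(q)$, $\pi_j(p)>\pi_j(q)$, $\pi_k(p)<\pi_k(q)$. -}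

module Defs where

open import Level using (0ℓ)
open import Data.Nat using (ℕ; zero; suc; _∸_; _≤_; _<_; _<ᵇ_)
open import Data.Fin using (Fin; zero; suc; toℕ; fromℕ)
open import Data.Fin.Permutation using (Permutation′; _⟨$⟩ʳ_)
open import Data.Bool using (Bool; true; false)
open import Data.Unit using (⊤)
open import Data.Product using (Σ; ∃; _×_; _,_)
open import Relation.Nullary using (¬_)
open import Relation.Binary.PropositionalEquality using (_≡_; _≢_)

-- A d-permutation of size n: a tuple (π₁,…,π_{d-1}) of permutations of [n].
-- Points are indexed by i ∈ Fin n (their 0-th coordinate, π₀ = id).
record DPerm (d n : ℕ) : Set where
  constructor dperm
  field perms : Fin (d ∸ 1) → Permutation′ n
open DPerm public

coord : ∀ {d n} → DPerm d n → Fin d → Fin n → Fin n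
coord {suc m} π zero    p = p
coord {suc m} π (suc l) p = perms π l ⟨$⟩ʳ p

-- Last ((d-1)-th) coordinate as a natural number (d = 0 never occurs; d ≥ 2 in the theorem).
lastCoord : ∀ {d n} → DPerm d n → Fin n → ℕ
lastCoord {zero}  π p = 0
lastCoord {suc m} π p = toℕ (coord π (fromℕ m) p)

-- Directions in {+1,-1}^d encoded as Fin d → Bool  (true = +1, false = -1).
Dir : ℕ → Set
Dir d = Fin d → Bool

_≈D_ : ∀ {d} → Dir d → Dir d → Set
f ≈D g = ∀ l → f l ≡ g l

dir : ∀ {d n} → DPerm d n → Fin n → Fin n → Dir d
dir π p q l = toℕ (coord π l p) <ᵇ toℕ (coord π l q)

InFd : ∀ {d} → Dir d → Set
InFd {d} f = ∀ l → suc (toℕ l) ≡ d → f l ≡ false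

dirF : ∀ {d} → Fin d → Dir d
dirF i l = toℕ l <ᵇ toℕ i

InF : ∀ {d} → Dir d → Set
InF {d} f = Σ (Fin d) λ i → f ≈D dirF i

-- Points of the subtree T_f(a), where S is the set of points of the subtree rooted at a.
Sub : ∀ {d n} → DPerm d n → Fin n → (Fin n → Set) → Dir d → Fin n → Set
Sub π a S f q = S q × q ≢ a × dir π a q ≈D f

-- Node π r S : r is (the point of) an internal node of the max-tree γ^d(π), and S is the
-- set of points of the subtree rooted at r.  (Relabelling is unnecessary: it preserves
-- directions and coordinate orders.)
data Node {d n : ℕ} (π : DPerm d n) : Fin n → (Fin n → Set) → Set₁ where
  root  : ∀ r → (∀ q → lastCoord π q ≤ lastCoord π r) → Node π r (λ _ → ⊤)
  child : ∀ {a S} → Node π a S → (f : Dir d) → InFd f →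
          ∀ r → Sub π a S f r → (∀ q → Sub π a S f q → lastCoord π q ≤ lastCoord π r) →
          Node π r (Sub π a S f)

Admissible : ∀ {d n} → DPerm d n → Set₁
Admissible {d} {n} π =
  (∀ r S → Node π r S → ∀ (l i j : Fin d) → toℕ i < toℕ j →
     ∀ q q' → Sub π r S (dirF i) q → Sub π r S (dirF j) q' →
     toℕ (coord π l q) < toℕ (coord π l q'))
  × (∀ r₂ S → Node π r₂ S → ∀ (f : Dir d) → InFd f → ¬ InF f →
     ∀ r₁ → ¬ Sub π r₂ S f r₁)

-- π contains (21,12) via a direct projection.
Contains2112 : ∀ {d n} → DPerm d n → Set
Contains2112 {d} {n} π =
  Σ (Fin n) λ p → Σ (Fin n) λ q → Σ (Fin d) λ i → Σ (Fin d) λ j → Σ (Fin d) λ k →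
    toℕ i < toℕ j × toℕ j < toℕ k ×
    toℕ (coord π i p) < toℕ (coord π i q) ×
    toℕ (coord π j q) < toℕ (coord π j p) ×
    toℕ (coord π k p) < toℕ (coord π k q)

{-# OPTIONS --safe #-}
-- Follow the subtrees of the max-tree that contain both points p, q of the occurrence.
-- The root of such a subtree is neither p nor q: the direction from p to q has a -1 at j
-- followed by a +1 at k (from q to p: a -1 at i followed by a +1 at j), whereas every
-- direction in F is a block of +1s followed by a block of -1s, so condition (ii) fails.
-- Hence p and q lie in children labelled dir^a and dir^b; condition (i) for coordinate j
-- rules out a < b and for coordinate i rules out a > b.  So both lie in the same child,
-- which is again such a subtree, and the descent cannot go on forever.

module Submission where

open import Defs
open import Data.Nat using (ℕ; _≤_)
open import Relation.Nullary using (¬_)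
open import Data.Bool using (true; false)
open import Data.Bool.Properties using (T-≡; ¬-not) renaming (_≟_ to _≟ᵇ_)
open import Data.Empty using (⊥; ⊥-elim)
open import Data.Fin using (Fin; zero; suc; toℕ; fromℕ)
open import Data.Fin.Properties using (toℕ-injective; toℕ-fromℕ; any?; all?)
  renaming (_≟_ to _≟ᶠ_)
open import Data.List using (filter; allFin)
open import Data.List.Membership.Propositional.Properties using (∈-allFin; ∈-filter⁺)
open import Data.List.Relation.Unary.All using (lookup)
open import Data.List.Relation.Unary.All.Properties using (all-filter)
open import Data.Nat using (suc; _<_; _<ᵇ_)
open import Data.Nat.Induction using (<-wellFounded)
open import Data.Nat.Properties
  using (≤-totalOrder; <⇒≤; ≤⇒≯; ≤∧≢⇒<; <-trans; <-irrefl; <-asym; <-cmp; <⇒<ᵇ; <ᵇ⇒<; suc-injective)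
open import Data.List.Extrema ≤-totalOrder using (argmax; argmax-all; f[xs]≤f[argmax])
open import Data.Product using (Σ; _×_; _,_; proj₁; proj₂)
open import Data.Unit using (⊤; tt)
open import Function using (_∘_)
open import Function.Bundles using (Equivalence; Injection)
open import Function.Properties.Inverse using (↔⇒↣)
open import Induction.WellFounded using (Acc; acc)
open import Level using (0ℓ)
open import Relation.Binary.Definitions using (tri<; tri≈; tri>)
open import Relation.Binary.PropositionalEquality using (_≡_; _≢_; refl; sym; trans; cong)
open import Relation.Nullary using (Dec; yes)
open import Relation.Nullary.Decidable using (_×-dec_; ¬?; decidable-stable)
open import Relation.Unary using (Pred; Decidable)

<⇒<ᵇ≡true : ∀ {m n} → m < n → (m <ᵇ n) ≡ true
<⇒<ᵇ≡true m<n = Equivalence.to T-≡ (<⇒<ᵇ m<n)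

<ᵇ≡true⇒< : ∀ {m n} → (m <ᵇ n) ≡ true → m < n
<ᵇ≡true⇒< {m} {n} eq = <ᵇ⇒< m n (Equivalence.from T-≡ eq)

≤⇒flip<ᵇ≡false : ∀ {m n} → n ≤ m → (m <ᵇ n) ≡ false
≤⇒flip<ᵇ≡false n≤m = ¬-not (≤⇒≯ n≤m ∘ <ᵇ≡true⇒<)

∃-argmax : ∀ {n} (g : Fin n → ℕ) {P : Pred (Fin n) 0ℓ} → Decidable P →
           ∀ {x} → P x → Σ (Fin n) λ r → P r × (∀ y → P y → g y ≤ g r)
∃-argmax {n} g P? {x} px =
  argmax g x xs , argmax-all g px (all-filter P? (allFin n)) ,
  λ y py → lookup (f[xs]≤f[argmax] x xs) (∈-filter⁺ P? (∈-allFin y) py)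
  where xs = filter P? (allFin n)

InF? : ∀ {d} (f : Dir d) → Dec (InF f)
InF? f = any? λ i → all? λ l → f l ≟ᵇ dirF i l

dirF-downward-closed : ∀ {d} (i : Fin d) {l l' : Fin d} → toℕ l < toℕ l' →
                       dirF i l' ≡ true → dirF i l ≡ true
dirF-downward-closed i l<l' l'<i = <⇒<ᵇ≡true (<-trans l<l' (<ᵇ≡true⇒< {n = toℕ i} l'<i))

ascent⇒¬InF : ∀ {d} {f : Dir d} {l l' : Fin d} → toℕ l < toℕ l' →
              f l ≡ false → f l' ≡ true → ¬ InF f
ascent⇒¬InF {l = l} {l'} l<l' fl≡false fl'≡true (i , f≈dirFᵢ)
  with () ← trans (sym fl≡false) (trans (f≈dirFᵢ l)
              (dirF-downward-closed i l<l' (trans (sym (f≈dirFᵢ l')) fl'≡true)))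

module _ {m n : ℕ} (π : DPerm (suc m) n) where

  coord-injective : ∀ l {a b} → coord π l a ≡ coord π l b → a ≡ b
  coord-injective zero    = λ eq → eq
  coord-injective (suc l) = Injection.injective (↔⇒↣ (perms π l))

  lastCoord-injective : ∀ {a b} → lastCoord π a ≡ lastCoord π b → a ≡ b
  lastCoord-injective = coord-injective (fromℕ m) ∘ toℕ-injective

  dir-to-lower-∈𝔽 : ∀ {r x} → lastCoord π x ≤ lastCoord π r → InFd (dir π r x)
  dir-to-lower-∈𝔽 x≤r l 1+l≡1+m
    with refl ← toℕ-injective {i = l} {j = fromℕ m}
                  (trans (suc-injective 1+l≡1+m) (sym (toℕ-fromℕ m)))
    = ≤⇒flip<ᵇ≡false x≤r

  Sub? : ∀ {a S} → Decidable S → (f : Dir (suc m)) → Decidable (Sub π a S f)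
  Sub? {a} S? f x = S? x ×-dec ¬? (x ≟ᶠ a) ×-dec all? (λ l → dir π a x l ≟ᵇ f l)

  subtree? : ∀ {r S} → Node π r S → Decidable S
  subtree? (root _ _)           _ = yes tt
  subtree? (child nd f _ _ _ _)   = Sub? (subtree? nd) f

  subtree-below-root : ∀ {r S} → Node π r S → ∀ {x} → S x → lastCoord π x ≤ lastCoord π r
  subtree-below-root (root _ max)          {x} _  = max x
  subtree-below-root (child _ _ _ _ _ max) {x} sx = max x sx

  root-node : Fin n → Σ (Fin n) λ r → Node π r (λ _ → ⊤)
  root-node p with r , _ , max ← ∃-argmax (lastCoord π) (λ _ → yes tt) {p} tt
    = r , root r (λ x → max x tt)

  -- The child is taken at the label dir π r x itself, so that x lies in it by reflexivity.
  child-node : ∀ {r S} → Node π r S → ∀ {x} → S x → x ≢ r →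
               Σ (Fin n) λ r' → Node π r' (Sub π r S (dir π r x))
                              × lastCoord π r' < lastCoord π r
  child-node {r} nd {x} sx x≢r
    with r' , sr'@(s'r' , r'≢r , _) , max ←
           ∃-argmax (lastCoord π) (Sub? (subtree? nd) (dir π r x)) {x} (sx , x≢r , λ _ → refl)
    = r' , child nd (dir π r x) (dir-to-lower-∈𝔽 (subtree-below-root nd sx)) r' sr' max ,
      ≤∧≢⇒< (subtree-below-root nd s'r') (r'≢r ∘ lastCoord-injective)

  module _ (adm : Admissible π) where

    subtree-dir-∈F : ∀ {r S} → Node π r S → ∀ {x} → S x → x ≢ r → InF (dir π r x)
    subtree-dir-∈F {r} {S} nd {x} sx x≢r = decidable-stable (InF? (dir π r x)) λ ¬inF →
      proj₂ adm r S nd (dir π r x) (dir-to-lower-∈𝔽 (subtree-below-root nd sx)) ¬inF x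
        (sx , x≢r , λ _ → refl)

    module _ {p q : Fin n} {i j k : Fin (suc m)} (i<j : toℕ i < toℕ j) (j<k : toℕ j < toℕ k)
             (pᵢ<qᵢ : toℕ (coord π i p) < toℕ (coord π i q))
             (qⱼ<pⱼ : toℕ (coord π j q) < toℕ (coord π j p))
             (pₖ<qₖ : toℕ (coord π k p) < toℕ (coord π k q)) where

      p≢q : p ≢ q
      p≢q refl = <-irrefl refl pᵢ<qᵢ

      p-not-subtree-root : ∀ {r S} → Node π r S → S q → p ≢ r
      p-not-subtree-root nd sq refl = ascent⇒¬InF j<k
        (≤⇒flip<ᵇ≡false (<⇒≤ qⱼ<pⱼ)) (<⇒<ᵇ≡true pₖ<qₖ) (subtree-dir-∈F nd sq (p≢q ∘ sym))

      q-not-subtree-root : ∀ {r S} → Node π r S → S p → q ≢ r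
      q-not-subtree-root nd sp refl = ascent⇒¬InF i<j
        (≤⇒flip<ᵇ≡false (<⇒≤ pᵢ<qᵢ)) (<⇒<ᵇ≡true qⱼ<pⱼ) (subtree-dir-∈F nd sp p≢q)

      same-child : ∀ {r S} → Node π r S → S p → S q → p ≢ r → q ≢ r →
                   dir π r q ≈D dir π r p
      same-child {r} {S} nd sp sq p≢r q≢r
        with a , dirp≈dirFa ← subtree-dir-∈F nd sp p≢r
           | b , dirq≈dirFb ← subtree-dir-∈F nd sq q≢r
        with <-cmp (toℕ a) (toℕ b)
      ... | tri< a<b _ _ = ⊥-elim (<-asym qⱼ<pⱼ
            (proj₁ adm r S nd j a b a<b p q (sp , p≢r , dirp≈dirFa) (sq , q≢r , dirq≈dirFb)))
      ... | tri> _ _ b<a = ⊥-elim (<-asym pᵢ<qᵢ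
            (proj₁ adm r S nd i b a b<a q p (sq , q≢r , dirq≈dirFb) (sp , p≢r , dirp≈dirFa)))
      ... | tri≈ _ a≡b _ = λ l →
            trans (dirq≈dirFb l) (trans (cong (toℕ l <ᵇ_) (sym a≡b)) (sym (dirp≈dirFa l)))

      occurrence-not-in-subtree : ∀ {r S} → Acc _<_ (lastCoord π r) →
                                  Node π r S → S p → S q → ⊥
      occurrence-not-in-subtree (acc rec) nd sp sq
        with p≢r ← p-not-subtree-root nd sq | q≢r ← q-not-subtree-root nd sp
        with r' , nd' , r'<r ← child-node nd sp p≢r
        = occurrence-not-in-subtree (rec r'<r) nd'
            (sp , p≢r , λ _ → refl) (sq , q≢r , same-child nd sp sq p≢r q≢r)

proposition2 : (d n : ℕ) → 2 ≤ d → (π : DPerm d n) → Contains2112 π → ¬ Admissible π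
proposition2 (suc m) n _ π (p , q , i , j , k , i<j , j<k , pᵢ<qᵢ , qⱼ<pⱼ , pₖ<qₖ) adm
  with r , root-r ← root-node π p
  = occurrence-not-in-subtree π adm i<j j<k pᵢ<qᵢ qⱼ<pⱼ pₖ<qₖ
      (<-wellFounded (lastCoord π r)) root-r tt tt
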